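{- For each even integer $d\ge 2$ and each $D\ge 1$, there exists a finite, connected, $d$-regular simple graph $G$ with diameter at least $D$ such that \[\min_{v,r}\delta(\mathcal{L}_r(v))=d/2-1,\] where the minimum is over all vertices $v$ of $G$ and all integers $r\ge 1$ with $\mathcal{S}_r(v)\neq\varnothing$.
   Context: For a graph $G$, a vertex $v$ and an integer $r>0$, the sphere $\mathcal{S}_r(v)=\{w\in V(G): d(v,w)=r\}$ is the set of vertices at graph distance exactly $r$ from $v$. If $\mathcal{S}_r(v)\neq\varnothing$, the $r$-link graph of $v$ is the induced subgraph $\mathcal{L}_r(v)=G[\mathcal{S}_r(v)]$. $\delta(H)$ denotes the minimum degree of a graph $H$. -}

module Defs where

open import Data.Nat using (ℕ; zero; suc; _<_; _≥_)
open import Data.Fin using (Fin)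
open import Data.List using (List; length)
open import Data.List.Membership.Propositional using (_∈_)
open import Data.List.Relation.Unary.Unique.Propositional using (Unique)
open import Data.Product using (Σ; ∃; _×_; _,_)
open import Relation.Nullary using (¬_)
open import Relation.Binary.PropositionalEquality using (_≡_)
open import Function.Bundles using (_⇔_)

record SimpleGraph (n : ℕ) : Set₁ where
  field
    Adj    : Fin n → Fin n → Set
    sym    : ∀ {u w} → Adj u w → Adj w u
    irrefl : ∀ {u} → ¬ Adj u u

module _ {n : ℕ} (G : SimpleGraph n) where
  open SimpleGraph G

  HasCard : (Fin n → Set) → ℕ → Set
  HasCard P k = Σ (List (Fin n)) λ xs →
    Unique xs × (∀ w → (w ∈ xs) ⇔ P w) × length xs ≡ k

  data Walk : Fin n → Fin n → ℕ → Set where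
    [] : ∀ {u} → Walk u u zero
    _∷_ : ∀ {u v w k} → Adj u v → Walk v w k → Walk u w (suc k)

  Dist : Fin n → Fin n → ℕ → Set
  Dist u w r = Walk u w r × (∀ k → k < r → ¬ Walk u w k)

  Connected : Set
  Connected = ∀ u w → ∃ λ k → Walk u w k

  Degree : Fin n → ℕ → Set
  Degree u k = HasCard (Adj u) k

  Regular : ℕ → Set
  Regular d = ∀ u → Degree u d

  DiameterAtLeast : ℕ → Set
  DiameterAtLeast D = ∃ λ u → ∃ λ w → ∃ λ r → Dist u w r × r ≥ D

  Sphere : Fin n → ℕ → Fin n → Set
  Sphere v r w = Dist v w r

  -- degree of u in the r-link graph L_r(v) = G[S_r(v)] (u ∈ S_r(v))
  LinkDegree : Fin n → ℕ → Fin n → ℕ → Set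
  LinkDegree v r u k = HasCard (λ w → Adj u w × Sphere v r w) k

-- The graph is the circulant graph on ℤ/2h joining residues at cyclic distance 1, …, t,
-- where t = d/2 and h = (K + 2) t. One step changes the cyclic distance ρ from a vertex v
-- by at most t, and steps of size at most t realise any ρ, so the sphere of radius r + 1
-- about v is {w : r t < ρ v w ≤ (r + 1) t}: two windows of t consecutive residues, one on
-- each side of v, far apart because (r + 1) t ≤ h. A vertex of a window is adjacent to the
-- other t − 1 vertices of its window, so every link degree is at least t − 1; for the
-- vertex v + t of the first sphere these are all its link neighbours, since the opposite
-- window lies at cyclic distance more than t from it. The antipode v + h has ρ = h, which
-- gives the diameter.

module Submission where

open import Defs
open import Data.Nat
open import Data.Nat.Properties
open import Data.Nat.DivMod using (_%_; m%n<n; m%n≤m; m%n%n≡m%n; [m+n]%n≡m%n; %-distribˡ-+; m<n⇒m%n≡m; m*n/n≡m)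
open import Data.Nat.Divisibility using (_∣_; divides)
open import Data.Nat.Tactic.RingSolver using (solve-∀)
open import Data.Fin using (Fin; toℕ; fromℕ; fromℕ<; splitAt; join; punchIn; punchOut) renaming (zero to fzero)
open import Data.Fin.Properties
  using (toℕ-injective; toℕ<n; toℕ-fromℕ; toℕ-fromℕ<; injective⇒≤; join-splitAt; splitAt-join;
         punchIn-injective; punchInᵢ≢i; punchIn-punchOut)
open import Data.List using (length; tabulate; filter; allFin; lookup)
open import Data.List.Properties using (length-tabulate)
open import Data.List.Relation.Unary.Any using (index)
open import Data.List.Relation.Unary.Any.Properties using (lookup-index)
open import Data.List.Membership.Propositional using (_∈_)
open import Data.List.Membership.Propositional.Properties
  using (∈-tabulate⁺; ∈-tabulate⁻; ∈-filter⁺; ∈-filter⁻; ∈-allFin)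
open import Data.List.Relation.Unary.Unique.Propositional.Properties using (tabulate⁺; filter⁺; allFin⁺)
open import Data.Empty using (⊥-elim)
open import Data.Product using (Σ; ∃; ∃₂; _×_; _,_; proj₁; proj₂)
open import Data.Sum using (_⊎_; inj₁; inj₂)
open import Function.Base using (_∘_)
open import Function.Bundles using (_⇔_; mk⇔; Equivalence)
open import Function.Definitions using (Injective)
open import Relation.Nullary using (¬_; contradiction; yes; no)
open import Relation.Nullary.Decidable using (Dec; _×-dec_; map′)
open import Relation.Unary using (Decidable)
open import Relation.Binary.Definitions using (tri<; tri≈; tri>)
open import Relation.Binary.PropositionalEquality

-- Walks and counting in simple graphs

module _ {n : ℕ} (G : SimpleGraph n) where
  open SimpleGraph G using (Adj; irrefl) renaming (sym to Adj-sym)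

  private variable
    x y z : Fin n
    k m : ℕ

  snoc : Walk G x y k → Adj y z → Walk G x z (suc k)
  snoc []       e = e ∷ []
  snoc (e ∷ w) e′ = e ∷ snoc w e′

  reverse : Walk G x y k → Walk G y x k
  reverse []      = []
  reverse (e ∷ w) = snoc (reverse w) (Adj-sym e)

  Adj⇒Dist-1 : Adj x y → Dist G x y 1
  Adj⇒Dist-1 e = e ∷ [] , λ { zero _ [] → irrefl e ; (suc _) (s≤s ()) _ }

  image-hasCard : {P : Fin n → Set} (f : Fin m → Fin n) → Injective _≡_ _≡_ f →
                  (∀ i → P (f i)) → (∀ {w} → P w → ∃ λ i → w ≡ f i) → HasCard G P m
  image-hasCard {P = P} f f-inj f∈P P⊆f =
    tabulate f , tabulate⁺ f-inj ,
    (λ w → mk⇔ (λ w∈ → let i , w≡fi = ∈-tabulate⁻ w∈ in subst P (sym w≡fi) (f∈P i))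
               (λ Pw → let i , w≡fi = P⊆f Pw in subst (_∈ tabulate f) (sym w≡fi) (∈-tabulate⁺ i))) ,
    length-tabulate f

  filter-hasCard : {P : Fin n → Set} (P? : Decidable P) → HasCard G P (length (filter P? (allFin n)))
  filter-hasCard P? =
    filter P? (allFin n) , filter⁺ P? (allFin⁺ n) ,
    (λ w → mk⇔ (proj₂ ∘ ∈-filter⁻ P? {xs = allFin n}) (∈-filter⁺ P? (∈-allFin w))) , refl

  injection⇒≤-card : {P : Fin n → Set} (f : Fin m → Fin n) → Injective _≡_ _≡_ f →
                     (∀ i → P (f i)) → HasCard G P k → m ≤ k
  injection⇒≤-card f f-inj f∈P (xs , _ , mem , refl) = injective⇒≤ pos-inj
    where
    pos : _ → Fin (length xs)
    pos i = index (Equivalence.from (mem (f i)) (f∈P i))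
    pos-inj : Injective _≡_ _≡_ pos
    pos-inj {i} {j} eq = f-inj (begin
      f i                ≡⟨ lookup-index (Equivalence.from (mem (f i)) (f∈P i)) ⟩
      lookup xs (pos i)  ≡⟨ cong (lookup xs) eq ⟩
      lookup xs (pos j)  ≡⟨ lookup-index (Equivalence.from (mem (f j)) (f∈P j)) ⟨
      f j                ∎)
      where open ≡-Reasoning

  injection⇒card≥ : {P : Fin n → Set} → Decidable P → (f : Fin m → Fin n) → Injective _≡_ _≡_ f →
                    (∀ i → P (f i)) → ∃ λ k → HasCard G P k × m ≤ k
  injection⇒card≥ P? f f-inj f∈P = _ , filter-hasCard P? , injection⇒≤-card f f-inj f∈P (filter-hasCard P?)

-- Arithmetic modulo N and the cycle ℤ/N

module Cyclic (N : ℕ) .{{_ : NonZero N}} where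

  infix 4 _≈_
  _≈_ : ℕ → ℕ → Set
  m ≈ n = m % N ≡ n % N

  %-≈ : ∀ m → m % N ≈ m
  %-≈ m = m%n%n≡m%n m N

  +-congʳ-≈ : ∀ {m n} o → m ≈ n → m + o ≈ n + o
  +-congʳ-≈ {m} {n} o m≈n = begin
    (m + o) % N            ≡⟨ %-distribˡ-+ m o N ⟩
    (m % N + o % N) % N    ≡⟨ cong (λ a → (a + o % N) % N) m≈n ⟩
    (n % N + o % N) % N    ≡⟨ %-distribˡ-+ n o N ⟨
    (n + o) % N            ∎
    where open ≡-Reasoning

  +-congˡ-≈ : ∀ {m n} o → m ≈ n → o + m ≈ o + n
  +-congˡ-≈ {m} {n} o m≈n =
    subst₂ _≈_ (+-comm m o) (+-comm n o) (+-congʳ-≈ o m≈n)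

  -- Adding N ∸ o cancels o, first for o < N and then for o % N.
  +-cancelʳ-≈ : ∀ {m n} o → m + o ≈ n + o → m ≈ n
  +-cancelʳ-≈ {m} {n} o eq = cancel (o % N) (m%n<n o N)
    (trans (+-congˡ-≈ m (%-≈ o)) (trans eq (sym (+-congˡ-≈ n (%-≈ o)))))
    where
    cancel : ∀ {m n} o → o < N → m + o ≈ n + o → m ≈ n
    cancel {m} {n} o o<N eq = begin
      m % N                     ≡⟨ [m+n]%n≡m%n m N ⟨
      (m + N) % N               ≡⟨ cong (λ a → (m + a) % N) (m+[n∸m]≡n (<⇒≤ o<N)) ⟨
      (m + (o + (N ∸ o))) % N   ≡⟨ cong (_% N) (+-assoc m o (N ∸ o)) ⟨
      (m + o + (N ∸ o)) % N     ≡⟨ +-congʳ-≈ (N ∸ o) eq ⟩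
      (n + o + (N ∸ o)) % N     ≡⟨ cong (_% N) (+-assoc n o (N ∸ o)) ⟩
      (n + (o + (N ∸ o))) % N   ≡⟨ cong (λ a → (n + a) % N) (m+[n∸m]≡n (<⇒≤ o<N)) ⟩
      (n + N) % N               ≡⟨ [m+n]%n≡m%n n N ⟩
      n % N                     ∎
      where open ≡-Reasoning

  <-≈⇒≡ : ∀ {m n} → m < N → n < N → m ≈ n → m ≡ n
  <-≈⇒≡ m<N n<N m≈n = trans (sym (m<n⇒m%n≡m m<N)) (trans m≈n (m<n⇒m%n≡m n<N))

  V : Set
  V = Fin N

  infixl 6 _⊕_ _⊖_
  _⊕_ : V → ℕ → V
  x ⊕ s = fromℕ< (m%n<n (toℕ x + s) N)

  _⊖_ : V → ℕ → V
  x ⊖ s = x ⊕ (N ∸ s)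

  toℕ-⊕ : ∀ x s → toℕ (x ⊕ s) ≡ (toℕ x + s) % N
  toℕ-⊕ x s = toℕ-fromℕ< (m%n<n (toℕ x + s) N)

  ≈⇒⊕≡ : ∀ x a y b → toℕ x + a ≈ toℕ y + b → x ⊕ a ≡ y ⊕ b
  ≈⇒⊕≡ x a y b eq = toℕ-injective (trans (toℕ-⊕ x a) (trans eq (sym (toℕ-⊕ y b))))

  ⊕≡⇒≈ : ∀ x a y b → x ⊕ a ≡ y ⊕ b → toℕ x + a ≈ toℕ y + b
  ⊕≡⇒≈ x a y b eq = trans (sym (toℕ-⊕ x a)) (trans (cong toℕ eq) (toℕ-⊕ y b))

  ⊕-identityʳ : ∀ x → x ⊕ 0 ≡ x
  ⊕-identityʳ x = toℕ-injective (begin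
    toℕ (x ⊕ 0)       ≡⟨ toℕ-⊕ x 0 ⟩
    (toℕ x + 0) % N   ≡⟨ cong (_% N) (+-identityʳ (toℕ x)) ⟩
    toℕ x % N         ≡⟨ m<n⇒m%n≡m (toℕ<n x) ⟩
    toℕ x             ∎)
    where open ≡-Reasoning

  ⊕-assoc : ∀ x a b → x ⊕ a ⊕ b ≡ x ⊕ (a + b)
  ⊕-assoc x a b = ≈⇒⊕≡ (x ⊕ a) b x (a + b) (begin
    (toℕ (x ⊕ a) + b) % N     ≡⟨ cong (λ c → (c + b) % N) (toℕ-⊕ x a) ⟩
    ((toℕ x + a) % N + b) % N ≡⟨ +-congʳ-≈ b (%-≈ (toℕ x + a)) ⟩
    (toℕ x + a + b) % N       ≡⟨ cong (_% N) (+-assoc (toℕ x) a b) ⟩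
    (toℕ x + (a + b)) % N     ∎)
    where open ≡-Reasoning

  ⊕-N : ∀ x → x ⊕ N ≡ x
  ⊕-N x = trans (≈⇒⊕≡ x N x 0 (trans ([m+n]%n≡m%n (toℕ x) N) (cong (_% N) (sym (+-identityʳ (toℕ x))))))
                (⊕-identityʳ x)

  ⊕-⊖ : ∀ x {s} → s ≤ N → x ⊕ s ⊖ s ≡ x
  ⊕-⊖ x {s} s≤N = trans (⊕-assoc x s (N ∸ s)) (trans (cong (x ⊕_) (m+[n∸m]≡n s≤N)) (⊕-N x))

  ⊕-cancelˡ : ∀ x {a b} → a < N → b < N → x ⊕ a ≡ x ⊕ b → a ≡ b
  ⊕-cancelˡ x {a} {b} a<N b<N eq = <-≈⇒≡ a<N b<N
    (+-cancelʳ-≈ (toℕ x) (subst₂ _≈_ (+-comm (toℕ x) _) (+-comm (toℕ x) _) (⊕≡⇒≈ x a x b eq)))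

  private
    +-exchange : ∀ a b c → a + (b + c) ≡ b + (a + c)
    +-exchange = solve-∀

  -- δ x y is the offset from x to y in ℤ/N, and ρ x y, the smaller of the two offsets
  -- between x and y, is their distance in the N-cycle.
  δ : V → V → ℕ
  δ x y = (toℕ y + (N ∸ toℕ x)) % N

  δ<N : ∀ x y → δ x y < N
  δ<N x y = m%n<n _ N

  ⊕-δ : ∀ x y → x ⊕ δ x y ≡ y
  ⊕-δ x y = toℕ-injective (begin
    toℕ (x ⊕ δ x y)                           ≡⟨ toℕ-⊕ x (δ x y) ⟩
    (toℕ x + (toℕ y + (N ∸ toℕ x)) % N) % N   ≡⟨ +-congˡ-≈ (toℕ x) (%-≈ _) ⟩
    (toℕ x + (toℕ y + (N ∸ toℕ x))) % N       ≡⟨ cong (_% N) (+-exchange (toℕ x) (toℕ y) _) ⟩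
    (toℕ y + (toℕ x + (N ∸ toℕ x))) % N       ≡⟨ cong (λ a → (toℕ y + a) % N) (m+[n∸m]≡n (<⇒≤ (toℕ<n x))) ⟩
    (toℕ y + N) % N                           ≡⟨ [m+n]%n≡m%n (toℕ y) N ⟩
    toℕ y % N                                 ≡⟨ m<n⇒m%n≡m (toℕ<n y) ⟩
    toℕ y                                     ∎)
    where open ≡-Reasoning

  δ-unique : ∀ x y {s} → s < N → x ⊕ s ≡ y → δ x y ≡ s
  δ-unique x y s<N eq = ⊕-cancelˡ x (δ<N x y) s<N (trans (⊕-δ x y) (sym eq))

  δ-⊕ : ∀ x {s} → s < N → δ x (x ⊕ s) ≡ s
  δ-⊕ x s<N = δ-unique x _ s<N refl

  δ-self : ∀ x → δ x x ≡ 0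
  δ-self x = δ-unique x x (>-nonZero⁻¹ N) (⊕-identityʳ x)

  ⊖-δ : ∀ x y → x ⊖ δ y x ≡ y
  ⊖-δ x y = trans (cong (_⊖ δ y x) (sym (⊕-δ y x))) (⊕-⊖ y (<⇒≤ (δ<N y x)))

  δ-flip : ∀ x y → δ x y ≢ 0 → δ y x ≡ N ∸ δ x y
  δ-flip x y δ≢0 = δ-unique y x (∸-monoʳ-< (n≢0⇒n>0 δ≢0) (<⇒≤ (δ<N x y))) (⊖-δ y x)

  δ-⊕-⊕ : ∀ x {a b} → a ≤ b → b < N → δ (x ⊕ a) (x ⊕ b) ≡ b ∸ a
  δ-⊕-⊕ x {a} {b} a≤b b<N = δ-unique _ _ (≤-<-trans (m∸n≤m b a) b<N)
    (trans (⊕-assoc x a (b ∸ a)) (cong (x ⊕_) (m+[n∸m]≡n a≤b)))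

  ⊕≢⊖ : ∀ x {a b} → 1 ≤ b → a + b < N → x ⊕ a ≢ x ⊖ b
  ⊕≢⊖ x {a} {b} 1≤b a+b<N eq = <-irrefl a+b≡N a+b<N
    where
    b<N : b < N
    b<N = ≤-<-trans (m≤n+m b a) a+b<N
    a≡N∸b : a ≡ N ∸ b
    a≡N∸b = trans (sym (δ-⊕ x (≤-<-trans (m≤m+n a b) a+b<N)))
                  (trans (cong (δ x) eq) (δ-⊕ x (∸-monoʳ-< 1≤b (<⇒≤ b<N))))
    a+b≡N : a + b ≡ N
    a+b≡N = trans (cong (_+ b) a≡N∸b) (m∸n+n≡m (<⇒≤ b<N))

  δ-≤-displacement : ∀ x y {a b} → toℕ x + a ≈ toℕ y + b → b ≤ a → δ x y ≤ a ∸ b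
  δ-≤-displacement x y {a} {b} eq b≤a =
    subst (_≤ a ∸ b) (sym (δ-unique x y (m%n<n (a ∸ b) N) x⊕[a∸b]≡y)) (m%n≤m (a ∸ b) N)
    where
    x+[a∸b]≈y : toℕ x + (a ∸ b) ≈ toℕ y + 0
    x+[a∸b]≈y = +-cancelʳ-≈ b (subst₂ _≈_
      (trans (cong (toℕ x +_) (sym (m∸n+n≡m b≤a))) (sym (+-assoc (toℕ x) (a ∸ b) b)))
      (cong (_+ b) (sym (+-identityʳ (toℕ y))))
      eq)
    x⊕[a∸b]≡y : x ⊕ (a ∸ b) % N ≡ y
    x⊕[a∸b]≡y = trans (≈⇒⊕≡ x ((a ∸ b) % N) x (a ∸ b) (+-congˡ-≈ (toℕ x) (%-≈ (a ∸ b))))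
                (trans (≈⇒⊕≡ x (a ∸ b) y 0 x+[a∸b]≈y) (⊕-identityʳ y))

  ‖_‖ : ℕ → ℕ
  ‖ s ‖ = s ⊓ (N ∸ s)

  ρ : V → V → ℕ
  ρ x y = δ x y ⊓ δ y x

  ρ-sym : ∀ x y → ρ x y ≡ ρ y x
  ρ-sym x y = ⊓-comm (δ x y) (δ y x)

  ρ-self : ∀ x → ρ x x ≡ 0
  ρ-self x = cong₂ _⊓_ (δ-self x) (δ-self x)

  ρ≡‖δ‖ : ∀ x y → ρ x y ≡ ‖ δ x y ‖
  ρ≡‖δ‖ x y with δ x y ≟ 0
  ... | yes δ≡0 rewrite δ≡0 = refl
  ... | no δ≢0 = cong (δ x y ⊓_) (δ-flip x y δ≢0)

  ρ-⊕ : ∀ x {s} → s < N → ρ x (x ⊕ s) ≡ ‖ s ‖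
  ρ-⊕ x s<N = trans (ρ≡‖δ‖ x _) (cong ‖_‖ (δ-⊕ x s<N))

  ρ-⊕-⊕ : ∀ x {a b} → a ≤ b → b < N → ρ (x ⊕ a) (x ⊕ b) ≡ ‖ b ∸ a ‖
  ρ-⊕-⊕ x {a} {b} a≤b b<N = trans (ρ≡‖δ‖ (x ⊕ a) (x ⊕ b)) (cong ‖_‖ (δ-⊕-⊕ x a≤b b<N))

  ⊕-ρ⊎⊖-ρ : ∀ x y → y ≡ x ⊕ ρ x y ⊎ y ≡ x ⊖ ρ x y
  ⊕-ρ⊎⊖-ρ x y with ⊓-sel (δ x y) (δ y x)
  ... | inj₁ ρ≡δ = inj₁ (sym (trans (cong (x ⊕_) ρ≡δ) (⊕-δ x y)))
  ... | inj₂ ρ≡δ = inj₂ (sym (trans (cong (x ⊖_) ρ≡δ) (⊖-δ x y)))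

  ρ-≤-displacement : ∀ x y {a b} → toℕ x + a ≈ toℕ y + b → ρ x y ≤ a + b
  ρ-≤-displacement x y {a} {b} eq with ≤-total b a
  ... | inj₁ b≤a = begin
    ρ x y   ≤⟨ m⊓n≤m (δ x y) (δ y x) ⟩
    δ x y   ≤⟨ δ-≤-displacement x y eq b≤a ⟩
    a ∸ b   ≤⟨ m∸n≤m a b ⟩
    a       ≤⟨ m≤m+n a b ⟩
    a + b   ∎
    where open ≤-Reasoning
  ... | inj₂ a≤b = begin
    ρ x y   ≤⟨ m⊓n≤n (δ x y) (δ y x) ⟩
    δ y x   ≤⟨ δ-≤-displacement y x (sym eq) a≤b ⟩
    b ∸ a   ≤⟨ m∸n≤m b a ⟩
    b       ≤⟨ m≤n+m b a ⟩
    a + b   ∎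
    where open ≤-Reasoning

  -- ρ x y is the least a + b with x + a ≡ y + b (mod N); adding two such displacements
  -- gives the triangle inequality.
  ρ-displacement : ∀ x y → ∃₂ λ a b → toℕ x + a ≈ toℕ y + b × a + b ≡ ρ x y
  ρ-displacement x y with ⊓-sel (δ x y) (δ y x)
  ... | inj₁ ρ≡δ = δ x y , 0 , ⊕≡⇒≈ x (δ x y) y 0 (trans (⊕-δ x y) (sym (⊕-identityʳ y))) ,
                   trans (+-identityʳ (δ x y)) (sym ρ≡δ)
  ... | inj₂ ρ≡δ = 0 , δ y x , ⊕≡⇒≈ x 0 y (δ y x) (trans (⊕-identityʳ x) (sym (⊕-δ y x))) , sym ρ≡δ

  ρ-triangle : ∀ x y z → ρ x z ≤ ρ x y + ρ y z
  ρ-triangle x y z with ρ-displacement x y | ρ-displacement y z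
  ... | a₁ , b₁ , eq₁ , s₁ | a₂ , b₂ , eq₂ , s₂ = begin
    ρ x z                     ≤⟨ ρ-≤-displacement x z x+a≈z+b ⟩
    (a₁ + a₂) + (b₂ + b₁)     ≡⟨ regroup a₁ a₂ b₂ b₁ ⟩
    (a₁ + b₁) + (a₂ + b₂)     ≡⟨ cong₂ _+_ s₁ s₂ ⟩
    ρ x y + ρ y z             ∎
    where
    open ≤-Reasoning
    regroup : ∀ a b c d → (a + b) + (c + d) ≡ (a + d) + (b + c)
    regroup = solve-∀
    shuffle : ∀ a b c → (a + b) + c ≡ (a + c) + b
    shuffle = solve-∀
    x+a≈z+b : toℕ x + (a₁ + a₂) ≈ toℕ z + (b₂ + b₁)
    x+a≈z+b = begin-equality
      (toℕ x + (a₁ + a₂)) % N   ≡⟨ cong (_% N) (+-assoc (toℕ x) a₁ a₂) ⟨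
      (toℕ x + a₁ + a₂) % N     ≡⟨ +-congʳ-≈ a₂ eq₁ ⟩
      (toℕ y + b₁ + a₂) % N     ≡⟨ cong (_% N) (shuffle (toℕ y) b₁ a₂) ⟩
      (toℕ y + a₂ + b₁) % N     ≡⟨ +-congʳ-≈ b₁ eq₂ ⟩
      (toℕ z + b₂ + b₁) % N     ≡⟨ cong (_% N) (+-assoc (toℕ z) b₂ b₁) ⟩
      (toℕ z + (b₂ + b₁)) % N   ∎

-- The circulant graph

module Circulant (p K : ℕ) where

  t h N : ℕ
  t = suc p
  h = (2 + K) * t
  N = h + h

  open Cyclic N public

  t+t≤h : t + t ≤ h
  t+t≤h = +-monoʳ-≤ t (m≤m+n t (K * t))

  t≤h : t ≤ h
  t≤h = ≤-trans (m≤m+n t t) t+t≤h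

  h<N : h < N
  h<N = m<m+n h {h} z<s

  h≤N∸s : ∀ {s} → s ≤ h → h ≤ N ∸ s
  h≤N∸s s≤h = ≤-trans (≤-reflexive (sym (m+n∸n≡m h h))) (∸-monoʳ-≤ N s≤h)

  ‖‖≤h : ∀ s → ‖ s ‖ ≤ h
  ‖‖≤h s with ≤-total s h
  ... | inj₁ s≤h = ≤-trans (m⊓n≤m s (N ∸ s)) s≤h
  ... | inj₂ h≤s = ≤-trans (m⊓n≤n s (N ∸ s)) (≤-trans (∸-monoʳ-≤ N h≤s) (≤-reflexive (m+n∸n≡m h h)))

  ‖‖-small : ∀ {s} → s ≤ h → ‖ s ‖ ≡ s
  ‖‖-small s≤h = m≤n⇒m⊓n≡m (≤-trans s≤h (h≤N∸s s≤h))

  ‖‖-reflect : ∀ {s} → s ≤ h → ‖ N ∸ s ‖ ≡ s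
  ‖‖-reflect {s} s≤h = begin
    (N ∸ s) ⊓ (N ∸ (N ∸ s))   ≡⟨ cong ((N ∸ s) ⊓_) (m∸[m∸n]≡n (≤-trans s≤h (<⇒≤ h<N))) ⟩
    (N ∸ s) ⊓ s               ≡⟨ ⊓-comm (N ∸ s) s ⟩
    s ⊓ (N ∸ s)               ≡⟨ ‖‖-small s≤h ⟩
    s                         ∎
    where open ≡-Reasoning

  Adjacent : V → V → Set
  Adjacent x y = 1 ≤ ρ x y × ρ x y ≤ t

  Adjacent-sym : ∀ x y → Adjacent x y → Adjacent y x
  Adjacent-sym x y = subst (λ r → 1 ≤ r × r ≤ t) (ρ-sym x y)

  Adjacent-irrefl : ∀ x → ¬ Adjacent x x
  Adjacent-irrefl x (1≤ρ , _) = contradiction (subst (1 ≤_) (ρ-self x) 1≤ρ) λ ()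

  circulant : SimpleGraph N
  circulant = record
    { Adj    = Adjacent
    ; sym    = λ {x} {y} → Adjacent-sym x y
    ; irrefl = λ {x} → Adjacent-irrefl x
    }

  -- One of the two halves of the cycle seen from v, parametrised by the distance from v.
  record Ray (v : V) (e : ℕ → V) : Set where
    field
      ρ-origin : ∀ {s} → 1 ≤ s → s ≤ h → ρ v (e s) ≡ s
      ρ-along  : ∀ {a b} → 1 ≤ a → a ≤ b → b ≤ h → ρ (e a) (e b) ≡ b ∸ a

  forward-ray : ∀ v → Ray v (v ⊕_)
  forward-ray v = record
    { ρ-origin = λ _ s≤h → trans (ρ-⊕ v (≤-<-trans s≤h h<N)) (‖‖-small s≤h)
    ; ρ-along  = λ {a} {b} _ a≤b b≤h → trans (ρ-⊕-⊕ v a≤b (≤-<-trans b≤h h<N))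
                                             (‖‖-small (≤-trans (m∸n≤m b a) b≤h))
    }

  backward-ray : ∀ v → Ray v (v ⊖_)
  backward-ray v = record
    { ρ-origin = λ 1≤s s≤h → trans (ρ-⊕ v (N∸<N 1≤s (≤-trans s≤h (<⇒≤ h<N)))) (‖‖-reflect s≤h)
    ; ρ-along  = ρ-along
    }
    where
    N∸<N : ∀ {s} → 1 ≤ s → s ≤ N → N ∸ s < N
    N∸<N 1≤s s≤N = ∸-monoʳ-< 1≤s s≤N
    ρ-along : ∀ {a b} → 1 ≤ a → a ≤ b → b ≤ h → ρ (v ⊖ a) (v ⊖ b) ≡ b ∸ a
    ρ-along {a} {b} 1≤a a≤b b≤h = begin
      ρ (v ⊖ a) (v ⊖ b)                 ≡⟨ ρ-sym (v ⊖ a) (v ⊖ b) ⟩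
      ρ (v ⊕ (N ∸ b)) (v ⊕ (N ∸ a))     ≡⟨ ρ-⊕-⊕ v (∸-monoʳ-≤ N a≤b) (N∸<N 1≤a (≤-trans a≤b b≤N)) ⟩
      ‖ (N ∸ a) ∸ (N ∸ b) ‖             ≡⟨ cong ‖_‖ N∸a∸[N∸b]≡b∸a ⟩
      ‖ b ∸ a ‖                         ≡⟨ ‖‖-small (≤-trans (m∸n≤m b a) b≤h) ⟩
      b ∸ a                             ∎
      where
      open ≡-Reasoning
      b≤N : b ≤ N
      b≤N = ≤-trans b≤h (<⇒≤ h<N)
      N∸a∸[N∸b]≡b∸a : (N ∸ a) ∸ (N ∸ b) ≡ b ∸ a
      N∸a∸[N∸b]≡b∸a = begin
        (N ∸ a) ∸ (N ∸ b)                 ≡⟨ cong (λ c → (c ∸ a) ∸ (N ∸ b)) (m∸n+n≡m b≤N) ⟨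
        ((N ∸ b) + b) ∸ a ∸ (N ∸ b)       ≡⟨ cong (_∸ (N ∸ b)) (+-∸-assoc (N ∸ b) a≤b) ⟩
        ((N ∸ b) + (b ∸ a)) ∸ (N ∸ b)     ≡⟨ m+n∸m≡n (N ∸ b) (b ∸ a) ⟩
        b ∸ a                             ∎

  module RayProperties {v : V} {e : ℕ → V} (R : Ray v e) where
    open Ray R

    ray-injective : ∀ {a b} → 1 ≤ a → 1 ≤ b → a ≤ h → b ≤ h → e a ≡ e b → a ≡ b
    ray-injective {a} {b} 1≤a 1≤b a≤h b≤h ea≡eb with ≤-total a b
    ... | inj₁ a≤b = ≤-antisym a≤b (m∸n≡0⇒m≤n (trans (sym (ρ-along 1≤a a≤b b≤h))
                                      (trans (cong (ρ (e a)) (sym ea≡eb)) (ρ-self (e a)))))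
    ... | inj₂ b≤a = ≤-antisym (m∸n≡0⇒m≤n (trans (sym (ρ-along 1≤b b≤a a≤h))
                                  (trans (cong (ρ (e b)) ea≡eb) (ρ-self (e b))))) b≤a

    origin-adjacent : ∀ {s} → 1 ≤ s → s ≤ t → Adjacent v (e s)
    origin-adjacent 1≤s s≤t = subst (λ r → 1 ≤ r × r ≤ t) (sym (ρ-origin 1≤s (≤-trans s≤t t≤h))) (1≤s , s≤t)

    along-adjacent : ∀ {a b} → 1 ≤ a → a < b → b ≤ h → b ≤ a + t → Adjacent (e a) (e b)
    along-adjacent {a} {b} 1≤a a<b b≤h b≤a+t =
      subst (λ r → 1 ≤ r × r ≤ t) (sym (ρ-along 1≤a (<⇒≤ a<b) b≤h)) (m<n⇒0<n∸m a<b , m≤n+o⇒m∸n≤o b a b≤a+t)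

  ρ-≤-walk : ∀ {x y k} → Walk circulant x y k → ρ x y ≤ k * t
  ρ-≤-walk {x} []                              = ≤-reflexive (ρ-self x)
  ρ-≤-walk {x} {y} (_∷_ {v = z} (_ , ρ≤t) w) = ≤-trans (ρ-triangle x z y) (+-mono-≤ ρ≤t (ρ-≤-walk w))

  ⊕-cons : ∀ x {e s r} → 1 ≤ e → e ≤ t → e ≤ s →
           Walk circulant (x ⊕ e) (x ⊕ e ⊕ (s ∸ e)) r → Walk circulant x (x ⊕ s) (suc r)
  ⊕-cons x {e} {s} {r} 1≤e e≤t e≤s w =
    subst (λ y → Walk circulant x y (suc r)) (trans (⊕-assoc x e (s ∸ e)) (cong (x ⊕_) (m+[n∸m]≡n e≤s)))
      (origin-adjacent 1≤e e≤t ∷ w)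
    where open RayProperties (forward-ray x)

  walk-⊕ : ∀ x {r s} → r ≤ s → s ≤ r * t → Walk circulant x (x ⊕ s) r
  walk-⊕ x {zero} {zero} _ _ = subst (λ y → Walk circulant x y 0) (sym (⊕-identityʳ x)) []
  walk-⊕ x {suc r} {s} r<s s≤[1+r]t with ≤-total t (s ∸ r)
  ... | inj₁ t≤s∸r =
    ⊕-cons x (s≤s z≤n) ≤-refl (≤-trans t≤s∸r (m∸n≤m s r))
      (walk-⊕ (x ⊕ t) r≤s∸t (m≤n+o⇒m∸n≤o s t s≤[1+r]t))
    where
    r≤s∸t : r ≤ s ∸ t
    r≤s∸t = begin
      r               ≡⟨ m+n∸m≡n t r ⟨
      t + r ∸ t       ≤⟨ ∸-monoˡ-≤ t (subst (t + r ≤_) (m∸n+n≡m (<⇒≤ r<s)) (+-monoˡ-≤ r t≤s∸r)) ⟩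
      s ∸ t           ∎
      where open ≤-Reasoning
  ... | inj₂ s∸r≤t =
    ⊕-cons x (m<n⇒0<n∸m r<s) s∸r≤t (m∸n≤m s r)
      (walk-⊕ (x ⊕ (s ∸ r)) (≤-reflexive (sym s∸[s∸r]≡r)) (≤-trans (≤-reflexive s∸[s∸r]≡r) (m≤m*n r t)))
    where
    s∸[s∸r]≡r : s ∸ (s ∸ r) ≡ r
    s∸[s∸r]≡r = m∸[m∸n]≡n (<⇒≤ r<s)

  walk-between : ∀ x y {k} → k ≤ ρ x y → ρ x y ≤ k * t → Walk circulant x y k
  walk-between x y {k} k≤ρ ρ≤kt with ⊓-sel (δ x y) (δ y x)
  ... | inj₁ ρ≡δ = subst (λ z → Walk circulant x z k) (⊕-δ x y)
                     (walk-⊕ x (subst (k ≤_) ρ≡δ k≤ρ) (subst (_≤ k * t) ρ≡δ ρ≤kt))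
  ... | inj₂ ρ≡δ = reverse circulant (subst (λ z → Walk circulant y z k) (⊕-δ y x)
                     (walk-⊕ y (subst (k ≤_) ρ≡δ k≤ρ) (subst (_≤ k * t) ρ≡δ ρ≤kt)))

  connected : Connected circulant
  connected x y = ρ x y , walk-between x y ≤-refl (m≤m*n (ρ x y) t)

  Dist-suc⇔ : ∀ {x y r} → Dist circulant x y (suc r) ⇔ (r * t < ρ x y × ρ x y ≤ suc r * t)
  Dist-suc⇔ {x} {y} {r} = mk⇔ to from
    where
    to : Dist circulant x y (suc r) → r * t < ρ x y × ρ x y ≤ suc r * t
    to (w , shortest) = ≰⇒> (λ ρ≤rt → shortest (r ⊓ ρ x y) (s≤s (m⊓n≤m r (ρ x y)))
                                        (walk-between x y (m⊓n≤n r (ρ x y)) (ρ≤[r⊓ρ]t ρ≤rt)))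
                        , ρ-≤-walk w
      where
      ρ≤[r⊓ρ]t : ρ x y ≤ r * t → ρ x y ≤ (r ⊓ ρ x y) * t
      ρ≤[r⊓ρ]t ρ≤rt = subst (ρ x y ≤_) (sym (*-distribʳ-⊓ t r (ρ x y))) (⊓-glb ρ≤rt (m≤m*n (ρ x y) t))
    from : r * t < ρ x y × ρ x y ≤ suc r * t → Dist circulant x y (suc r)
    from (rt<ρ , ρ≤[1+r]t) =
      walk-between x y (≤-<-trans (m≤m*n r t) rt<ρ) ρ≤[1+r]t ,
      λ k k≤r w → <⇒≱ rt<ρ (≤-trans (ρ-≤-walk w) (*-monoˡ-≤ t (s≤s⁻¹ k≤r)))

  Dist-suc? : ∀ x y r → Dec (Dist circulant x y (suc r))
  Dist-suc? x y r = map′ (Equivalence.from Dist-suc⇔) (Equivalence.to Dist-suc⇔) (r * t <? ρ x y ×-dec ρ x y ≤? suc r * t)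

  Adjacent? : ∀ x y → Dec (Adjacent x y)
  Adjacent? x y = 1 ≤? ρ x y ×-dec ρ x y ≤? t

  offset-index : ∀ {s} → 1 ≤ s → s ≤ t → ∃ λ (j : Fin t) → suc (toℕ j) ≡ s
  offset-index {suc s} _ s<t = fromℕ< s<t , cong suc (toℕ-fromℕ< s<t)

  private
    1+j≤t : ∀ (j : Fin t) → suc (toℕ j) ≤ t
    1+j≤t = toℕ<n

    1+j≤h : ∀ (j : Fin t) → suc (toℕ j) ≤ h
    1+j≤h j = ≤-trans (1+j≤t j) t≤h

    1+i+1+j<N : ∀ (i j : Fin t) → suc (toℕ i) + suc (toℕ j) < N
    1+i+1+j<N i j = ≤-<-trans (≤-trans (+-mono-≤ (1+j≤t i) (1+j≤t j)) t+t≤h) h<N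

  side : V → Fin t ⊎ Fin t → V
  side u (inj₁ j) = u ⊕ suc (toℕ j)
  side u (inj₂ j) = u ⊖ suc (toℕ j)

  side-adjacent : ∀ u i → Adjacent u (side u i)
  side-adjacent u (inj₁ j) = RayProperties.origin-adjacent (forward-ray u) (s≤s z≤n) (1+j≤t j)
  side-adjacent u (inj₂ j) = RayProperties.origin-adjacent (backward-ray u) (s≤s z≤n) (1+j≤t j)

  side-injective : ∀ u → Injective _≡_ _≡_ (side u)
  side-injective u {inj₁ i} {inj₁ j} eq = cong inj₁ (toℕ-injective (suc-injective
    (RayProperties.ray-injective (forward-ray u) (s≤s z≤n) (s≤s z≤n) (1+j≤h i) (1+j≤h j) eq)))
  side-injective u {inj₂ i} {inj₂ j} eq = cong inj₂ (toℕ-injective (suc-injective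
    (RayProperties.ray-injective (backward-ray u) (s≤s z≤n) (s≤s z≤n) (1+j≤h i) (1+j≤h j) eq)))
  side-injective u {inj₁ i} {inj₂ j} eq = contradiction eq (⊕≢⊖ u (s≤s z≤n) (1+i+1+j<N i j))
  side-injective u {inj₂ i} {inj₁ j} eq = contradiction (sym eq) (⊕≢⊖ u (s≤s z≤n) (1+i+1+j<N j i))

  neighbour : V → Fin (t + t) → V
  neighbour u = side u ∘ splitAt t

  regular : Regular circulant (t + t)
  regular u = image-hasCard circulant (neighbour u) (splitAt-injective ∘ side-injective u)
                (side-adjacent u ∘ splitAt t) surjective
    where
    splitAt-injective : Injective _≡_ _≡_ (splitAt t {t})
    splitAt-injective {i} {j} eq = trans (sym (join-splitAt t t i)) (trans (cong (join t t) eq) (join-splitAt t t j))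
    side≡neighbour : ∀ i → side u i ≡ neighbour u (join t t i)
    side≡neighbour i = cong (side u) (sym (splitAt-join t t i))
    surjective : ∀ {w} → Adjacent u w → ∃ λ i → w ≡ neighbour u i
    surjective {w} (1≤ρ , ρ≤t) with offset-index 1≤ρ ρ≤t | ⊕-ρ⊎⊖-ρ u w
    ... | j , 1+j≡ρ | inj₁ w≡u⊕ρ = join t t (inj₁ j) ,
          trans w≡u⊕ρ (trans (cong (u ⊕_) (sym 1+j≡ρ)) (side≡neighbour (inj₁ j)))
    ... | j , 1+j≡ρ | inj₂ w≡u⊖ρ = join t t (inj₂ j) ,
          trans w≡u⊖ρ (trans (cong (u ⊖_) (sym 1+j≡ρ)) (side≡neighbour (inj₂ j)))

  slot : ℕ → Fin t → ℕ
  slot r j = r * t + suc (toℕ j)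

  slot-window : ∀ r j → r * t < slot r j × slot r j ≤ suc r * t
  slot-window r j = m<m+n (r * t) z<s , ≤-trans (+-monoʳ-≤ (r * t) (1+j≤t j)) (≤-reflexive (+-comm (r * t) t))

  window-slot : ∀ {r s} → r * t < s → s ≤ suc r * t → ∃ λ j → slot r j ≡ s
  window-slot {r} {s} rt<s s≤[1+r]t with offset-index (m<n⇒0<n∸m rt<s) (m≤n+o⇒m∸n≤o s (r * t) s≤rt+t)
    where s≤rt+t = ≤-trans s≤[1+r]t (≤-reflexive (+-comm t (r * t)))
  ... | j , 1+j≡s∸rt = j , trans (cong (r * t +_) 1+j≡s∸rt) (m+[n∸m]≡n (<⇒≤ rt<s))

  slot-injective : ∀ r → Injective _≡_ _≡_ (slot r)
  slot-injective r eq = toℕ-injective (suc-injective (+-cancelˡ-≡ (r * t) _ _ eq))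

  module RayLink {v : V} {e : ℕ → V} (R : Ray v e) (r : ℕ) (r-bound : suc r * t ≤ h) (j₀ : Fin t) where
    open Ray R
    open RayProperties R

    private
      1≤slot : ∀ j → 1 ≤ slot r j
      1≤slot j = ≤-<-trans z≤n (proj₁ (slot-window r j))

      slot≤h : ∀ j → slot r j ≤ h
      slot≤h j = ≤-trans (proj₂ (slot-window r j)) r-bound

      slot<slot+t : ∀ i j → slot r i < slot r j + t
      slot<slot+t i j = ≤-<-trans (proj₂ (slot-window r i))
        (subst (_< slot r j + t) (+-comm (r * t) t) (+-monoˡ-< t (proj₁ (slot-window r j))))

    slot-adjacent : ∀ {i j} → i ≢ j → Adjacent (e (slot r i)) (e (slot r j))
    slot-adjacent {i} {j} i≢j with <-cmp (slot r i) (slot r j)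
    ... | tri< lt _ _ = along-adjacent (1≤slot i) lt (slot≤h j) (<⇒≤ (slot<slot+t j i))
    ... | tri≈ _ eq _ = contradiction (slot-injective r eq) i≢j
    ... | tri> _ _ gt = Adjacent-sym (e (slot r j)) (e (slot r i)) (along-adjacent (1≤slot j) gt (slot≤h i) (<⇒≤ (slot<slot+t i j)))

    slot-sphere : ∀ j → Dist circulant v (e (slot r j)) (suc r)
    slot-sphere j = Equivalence.from Dist-suc⇔
      (subst (λ s → r * t < s × s ≤ suc r * t) (sym (ρ-origin (1≤slot j) (slot≤h j))) (slot-window r j))

    link-neighbour : Fin p → V
    link-neighbour i = e (slot r (punchIn j₀ i))

    link-neighbour-injective : Injective _≡_ _≡_ link-neighbour
    link-neighbour-injective {i} {j} eq = punchIn-injective j₀ i j (slot-injective r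
      (ray-injective (1≤slot _) (1≤slot _) (slot≤h _) (slot≤h _) eq))

    link-neighbour-linked : ∀ i → Adjacent (e (slot r j₀)) (link-neighbour i) × Dist circulant v (link-neighbour i) (suc r)
    link-neighbour-linked i = slot-adjacent (punchInᵢ≢i j₀ i ∘ sym) , slot-sphere (punchIn j₀ i)

    slot-linkDegree-≥ : ∃ λ k → LinkDegree circulant v (suc r) (e (slot r j₀)) k × p ≤ k
    slot-linkDegree-≥ = injection⇒card≥ circulant (λ w → Adjacent? (e (slot r j₀)) w ×-dec Dist-suc? v w r)
                     link-neighbour link-neighbour-injective link-neighbour-linked

  sphere-bound : ∀ v u r → Dist circulant v u (suc r) → suc r * t ≤ h
  sphere-bound v u r d = *-monoˡ-≤ t (*-cancelʳ-< t r (2 + K) (<-≤-trans rt<ρ ρ≤h))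
    where
    rt<ρ : r * t < ρ v u
    rt<ρ = proj₁ (Equivalence.to Dist-suc⇔ d)
    ρ≤h : ρ v u ≤ h
    ρ≤h = subst (_≤ h) (sym (ρ≡‖δ‖ v u)) (‖‖≤h (δ v u))

  linkDegree-≥ : ∀ v r u → Dist circulant v u (suc r) → ∃ λ k → LinkDegree circulant v (suc r) u k × p ≤ k
  linkDegree-≥ v r u d with Equivalence.to Dist-suc⇔ d
  ... | rt<ρ , ρ≤[1+r]t with window-slot {r} rt<ρ ρ≤[1+r]t | ⊕-ρ⊎⊖-ρ v u
  ... | j₀ , slot≡ρ | inj₁ u≡v⊕ρ = subst (λ w → ∃ λ k → LinkDegree circulant v (suc r) w k × p ≤ k)
          (sym (trans u≡v⊕ρ (cong (v ⊕_) (sym slot≡ρ))))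
          (RayLink.slot-linkDegree-≥ (forward-ray v) r (sphere-bound v u r d) j₀)
  ... | j₀ , slot≡ρ | inj₂ u≡v⊖ρ = subst (λ w → ∃ λ k → LinkDegree circulant v (suc r) w k × p ≤ k)
          (sym (trans u≡v⊖ρ (cong (v ⊖_) (sym slot≡ρ))))
          (RayLink.slot-linkDegree-≥ (backward-ray v) r (sphere-bound v u r d) j₀)

  ⊕-⊖-nonadjacent : ∀ v {s} → 1 ≤ s → s ≤ t → ¬ Adjacent (v ⊕ t) (v ⊖ s)
  ⊕-⊖-nonadjacent v {s} 1≤s s≤t (_ , ρ≤t) = <⇒≱ (m<n+m t 1≤s) (subst (_≤ t) ρ≡s+t ρ≤t)
    where
    s≤h : s ≤ h
    s≤h = ≤-trans s≤t t≤h
    ρ≡s+t : ρ (v ⊕ t) (v ⊖ s) ≡ s + t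
    ρ≡s+t = begin
      ρ (v ⊕ t) (v ⊕ (N ∸ s))   ≡⟨ ρ-⊕-⊕ v (≤-trans t≤h (h≤N∸s s≤h)) (∸-monoʳ-< 1≤s (≤-trans s≤h (<⇒≤ h<N))) ⟩
      ‖ N ∸ s ∸ t ‖             ≡⟨ cong ‖_‖ (∸-+-assoc N s t) ⟩
      ‖ N ∸ (s + t) ‖           ≡⟨ ‖‖-reflect (≤-trans (+-monoˡ-≤ t s≤t) t+t≤h) ⟩
      s + t                     ∎
      where open ≡-Reasoning

  linkDegree-exact : ∀ v → LinkDegree circulant v 1 (v ⊕ t) p
  linkDegree-exact v = subst (λ s → LinkDegree circulant v 1 (v ⊕ s) p) (cong suc (toℕ-fromℕ p))
    (image-hasCard circulant link-neighbour link-neighbour-injective link-neighbour-linked surjective)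
    where
    j₀ : Fin t
    j₀ = fromℕ p
    open RayLink (forward-ray v) 0 (≤-trans (≤-reflexive (+-identityʳ t)) t≤h) j₀
    u : V
    u = v ⊕ slot 0 j₀
    surjective : ∀ {w} → Adjacent u w × Dist circulant v w 1 → ∃ λ i → w ≡ link-neighbour i
    surjective {w} (u~w , d) with Equivalence.to Dist-suc⇔ d
    ... | 0<ρ , ρ≤1*t with window-slot {0} 0<ρ ρ≤1*t | ⊕-ρ⊎⊖-ρ v w
    ... | j , slot≡ρ | inj₁ w≡v⊕ρ = punchOut j₀≢j , trans w≡ (cong (λ k → v ⊕ slot 0 k) (sym (punchIn-punchOut j₀≢j)))
      where
      w≡ : w ≡ v ⊕ slot 0 j
      w≡ = trans w≡v⊕ρ (cong (v ⊕_) (sym slot≡ρ))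
      j₀≢j : j₀ ≢ j
      j₀≢j refl = Adjacent-irrefl u (subst (Adjacent u) w≡ u~w)
    ... | _ | inj₂ w≡v⊖ρ = ⊥-elim (⊕-⊖-nonadjacent v 0<ρ (subst (ρ v w ≤_) (+-identityʳ t) ρ≤1*t)
          (subst₂ Adjacent (cong (λ s → v ⊕ suc s) (toℕ-fromℕ p)) w≡v⊖ρ u~w))

  diameter : ∀ v → Dist circulant v (v ⊕ h) (2 + K)
  diameter v = Equivalence.from Dist-suc⇔
    (subst (λ s → suc K * t < s × s ≤ h) (sym (trans (ρ-⊕ v h<N) (‖‖-small ≤-refl)))
      (*-monoˡ-< t (n<1+n (suc K)) , ≤-refl))

proposition3 : (d D : ℕ) → 2 ∣ d → 2 ≤ d → 1 ≤ D →
    Σ ℕ λ n → Σ (SimpleGraph n) λ G →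
      Connected G × Regular G d × DiameterAtLeast G D
      × (∀ v r u → 1 ≤ r → Sphere G v r u →
           ∃ λ k → LinkDegree G v r u k × k ≥ d / 2 ∸ 1)
      × (∃ λ v → ∃ λ r → ∃ λ u → 1 ≤ r × Sphere G v r u
           × LinkDegree G v r u (d / 2 ∸ 1))
proposition3 .(0 * 2)     D         (divides zero refl)    ()  _
proposition3 .(suc p * 2) (suc D′) (divides (suc p) refl) _   _ rewrite m*n/n≡m (suc p) 2 ⦃ _ ⦄ =
  N , circulant , connected , subst (Regular circulant) t+t≡2t regular ,
  (fzero , fzero ⊕ h , 2 + D′ , diameter fzero , n≤1+n (suc D′)) ,
  (λ { v (suc r) u _ v-u → linkDegree-≥ v r u v-u }) ,
  (fzero , 1 , fzero ⊕ t , ≤-refl ,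
   Adj⇒Dist-1 circulant (RayProperties.origin-adjacent (forward-ray fzero) (s≤s z≤n) ≤-refl) ,
   linkDegree-exact fzero)
  where
  open Circulant p D′
  t+t≡2t : t + t ≡ t * 2
  t+t≡2t = trans (cong (t +_) (sym (+-identityʳ t))) (*-comm 2 t)
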